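{- The Petersen graph is stackable.
   Context: A configuration is a function $C:V(G)\to\mathbb{N}$ (numbers of cups). A cup stacking move from $u$ to $v$ is allowed when $C(u)\ge1$, $C(v)\ge1$ and $\mathrm{dist}_G(u,v)=C(u)$; it moves all cups of $u$ onto $v$. Let $\mathbf{1}$ be the configuration with one cup on every vertex. $G$ is $r$-stackable if some sequence of moves from $\mathbf{1}$ puts all cups on $r$, and stackable if it is $r$-stackable for every vertex $r$. -}

module Defs where

open import Data.Nat using (ℕ; zero; suc; _+_; _≤_; _≥_)
open import Data.Fin using (Fin; toℕ) renaming (zero to fz; suc to fs)
open import Data.Fin.Properties using (_≟_)
open import Data.Bool using (Bool; true; false; T; _∨_; _∧_; if_then_else_)
open import Data.List using (List; []; _∷_)
open import Data.Bool.ListAction using (any)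
open import Data.Product using (Σ; ∃; _×_; _,_)
open import Relation.Nullary using (¬_)
open import Relation.Nullary.Decidable using (⌊_⌋)
open import Relation.Binary.PropositionalEquality using (_≡_)
open import Relation.Binary.Construct.Closure.ReflexiveTransitive using (Star)

Graph : ℕ → Set₁
Graph n = Fin n → Fin n → Set

module _ {n : ℕ} (G : Graph n) where

  data Walk : Fin n → Fin n → ℕ → Set where
    nil  : ∀ {u} → Walk u u 0
    cons : ∀ {u w v k} → G u w → Walk w v k → Walk u v (suc k)

  Dist : Fin n → Fin n → ℕ → Set
  Dist u v d = Walk u v d × (∀ k → Walk u v k → d ≤ k)

  -- configurations: number of cups on each vertex
  Config : Set
  Config = Fin n → ℕ

  moveCups : Config → Fin n → Fin n → Config
  moveCups C u v x =
    if ⌊ x ≟ v ⌋ then C u + C v else (if ⌊ x ≟ u ⌋ then 0 else C x)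

  data Move : Config → Config → Set where
    move : ∀ C u v → C u ≥ 1 → C v ≥ 1 → Dist u v (C u) →
           Move C (moveCups C u v)

  one : Config
  one _ = 1

  AllOn : Fin n → Config → Set
  AllOn r C = ∀ x → ¬ (x ≡ r) → C x ≡ 0

  Stackable-at : Fin n → Set
  Stackable-at r = Σ Config λ C → Star Move one C × AllOn r C

  Stackable : Set
  Stackable = ∀ r → Stackable-at r

-- The Petersen graph: outer 5-cycle 0-1-2-3-4, spokes i-(i+5),
-- inner pentagram 5-7-9-6-8-5.
petersenEdges : List (ℕ × ℕ)
petersenEdges =
  (0 , 1) ∷ (1 , 2) ∷ (2 , 3) ∷ (3 , 4) ∷ (4 , 0) ∷
  (0 , 5) ∷ (1 , 6) ∷ (2 , 7) ∷ (3 , 8) ∷ (4 , 9) ∷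
  (5 , 7) ∷ (7 , 9) ∷ (9 , 6) ∷ (6 , 8) ∷ (8 , 5) ∷ []

private
  eqℕ : ℕ → ℕ → Bool
  eqℕ zero zero = true
  eqℕ (suc a) (suc b) = eqℕ a b
  eqℕ _ _ = false

  hasEdge : ℕ → ℕ → (ℕ × ℕ) → Bool
  hasEdge a b (x , y) = (eqℕ a x ∧ eqℕ b y) ∨ (eqℕ a y ∧ eqℕ b x)

petersenAdj : Fin 10 → Fin 10 → Bool
petersenAdj u v = any (hasEdge (toℕ u) (toℕ v)) petersenEdges

Petersen : Graph 10
Petersen u v = T (petersenAdj u v)

-- The Petersen graph has diameter 2, so a stack can only ever move if it has
-- one cup (onto a neighbour) or two cups (onto a non-neighbour).  For every
-- root we exhibit an explicit sequence of nine such moves gathering all ten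
-- cups there; a sound checker for move sequences, run by the type checker,
-- turns these sequences into derivations.
module Submission where

open import Defs
open import Data.Nat using (ℕ; zero; suc; _≤_; _≤?_; z≤n; s≤s)
import Data.Nat.Properties as ℕ
open import Data.Fin using (Fin; #_) renaming (zero to fz; suc to fs)
open import Data.Fin.Properties using (_≟_; any?; all?)
open import Data.List using (List; []; _∷_)
open import Data.Vec using (Vec; lookup) renaming ([] to []ᵥ; _∷_ to _∷ᵥ_)
open import Data.Maybe using (Maybe; just; nothing; _>>=_; from-just)
open import Data.Product using (∃; _×_; _,_)
open import Relation.Nullary using (¬_; yes; no; contradiction)
open import Relation.Nullary.Decidable using (T?; ¬?; _×-dec_; _→-dec_; dec⇒maybe)
open import Relation.Binary using (Decidable)
open import Relation.Binary.PropositionalEquality using (_≡_; refl)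
open import Relation.Binary.Construct.Closure.ReflexiveTransitive using (Star; ε; _◅_)

module _ {n : ℕ} {G : Graph n} where

  walk-zero⇒≡ : ∀ {u v} → Walk G u v 0 → u ≡ v
  walk-zero⇒≡ nil = refl

  walk-one⇒adjacent : ∀ {u v} → Walk G u v 1 → G u v
  walk-one⇒adjacent (cons uv nil) = uv

  dist-one : ∀ {u v} → ¬ u ≡ v → G u v → Dist G u v 1
  dist-one {u} {v} u≢v uv = cons uv nil , minimal
    where
    minimal : ∀ k → Walk G u v k → 1 ≤ k
    minimal zero    w = contradiction (walk-zero⇒≡ w) u≢v
    minimal (suc k) _ = s≤s z≤n

  dist-two : ∀ {u v w} → ¬ u ≡ v → ¬ G u v → G u w → G w v → Dist G u v 2
  dist-two {u} {v} u≢v ¬uv uw wv = cons uw (cons wv nil) , minimal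
    where
    minimal : ∀ k → Walk G u v k → 2 ≤ k
    minimal zero          w = contradiction (walk-zero⇒≡ w) u≢v
    minimal (suc zero)    w = contradiction (walk-one⇒adjacent w) ¬uv
    minimal (suc (suc k)) _ = s≤s (s≤s z≤n)

sequenceᶠ : ∀ {n} {P : Fin n → Set} → (∀ i → Maybe (P i)) → Maybe (∀ i → P i)
sequenceᶠ {zero}  f = just λ ()
sequenceᶠ {suc n} f =
  f fz >>= λ p₀ →
  sequenceᶠ (λ i → f (fs i)) >>= λ ps →
  just λ { fz → p₀ ; (fs i) → ps i }

-- A script lists moves (u , v): all cups of u go onto v.
Script : ℕ → Set
Script n = List (Fin n × Fin n)

module _ {n : ℕ} {G : Graph n} (G? : Decidable G) where

  -- Only distances 1 and 2 are recognised; that suffices for diameter 2.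
  dist? : ∀ u v d → Maybe (Dist G u v d)
  dist? u v 1 with u ≟ v | G? u v
  ... | no u≢v | yes uv = just (dist-one u≢v uv)
  ... | _      | _      = nothing
  dist? u v 2 with u ≟ v | G? u v | any? (λ w → G? u w ×-dec G? w v)
  ... | no u≢v | no ¬uv | yes (w , uw , wv) = just (dist-two u≢v ¬uv uw wv)
  ... | _      | _      | _                 = nothing
  dist? _ _ _ = nothing

  move? : ∀ C u v → Maybe (Move G C (moveCups G C u v))
  move? C u v with 1 ≤? C u | 1 ≤? C v | dist? u v (C u)
  ... | yes u≥1 | yes v≥1 | just d = just (move C u v u≥1 v≥1 d)
  ... | _       | _       | _      = nothing

  play? : ∀ C → Script n → Maybe (∃ (Star (Move G) C))
  play? C []             = just (C , ε)
  play? C ((u , v) ∷ ms) =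
    move? C u v >>= λ m →
    play? (moveCups G C u v) ms >>= λ { (D , s) →
    just (D , m ◅ s) }

  allOn? : ∀ r C → Maybe (AllOn G r C)
  allOn? r C = dec⇒maybe (all? λ x → ¬? (x ≟ r) →-dec (C x ℕ.≟ 0))

  stackableAt? : ∀ r → Script n → Maybe (Stackable-at G r)
  stackableAt? r ms =
    play? (one G) ms >>= λ { (C , s) →
    allOn? r C >>= λ a →
    just (C , s , a) }

  stackable? : (Fin n → Script n) → Maybe (Stackable G)
  stackable? scripts = sequenceᶠ λ r → stackableAt? r (scripts r)

petersen? : Decidable Petersen
petersen? u v = T? (petersenAdj u v)

petersenScripts : Vec (Script 10) 10
petersenScripts =
  ((# 1 , # 0) ∷ (# 2 , # 3) ∷ (# 3 , # 0) ∷ (# 4 , # 0) ∷ (# 5 , # 0) ∷ (# 6 , # 8) ∷ (# 7 , # 9) ∷ (# 8 , # 0) ∷ (# 9 , # 0) ∷ []) ∷ᵥ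
  ((# 0 , # 1) ∷ (# 2 , # 1) ∷ (# 3 , # 4) ∷ (# 4 , # 1) ∷ (# 5 , # 8) ∷ (# 6 , # 1) ∷ (# 7 , # 9) ∷ (# 8 , # 1) ∷ (# 9 , # 1) ∷ []) ∷ᵥ
  ((# 0 , # 4) ∷ (# 1 , # 2) ∷ (# 3 , # 2) ∷ (# 4 , # 2) ∷ (# 5 , # 8) ∷ (# 6 , # 9) ∷ (# 7 , # 2) ∷ (# 8 , # 2) ∷ (# 9 , # 2) ∷ []) ∷ᵥ
  ((# 0 , # 1) ∷ (# 1 , # 3) ∷ (# 2 , # 3) ∷ (# 4 , # 3) ∷ (# 5 , # 7) ∷ (# 6 , # 9) ∷ (# 7 , # 3) ∷ (# 8 , # 3) ∷ (# 9 , # 3) ∷ []) ∷ᵥ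
  ((# 0 , # 1) ∷ (# 1 , # 4) ∷ (# 2 , # 7) ∷ (# 3 , # 4) ∷ (# 5 , # 8) ∷ (# 7 , # 4) ∷ (# 8 , # 4) ∷ (# 9 , # 6) ∷ (# 6 , # 4) ∷ []) ∷ᵥ
  ((# 0 , # 1) ∷ (# 1 , # 5) ∷ (# 2 , # 3) ∷ (# 3 , # 5) ∷ (# 4 , # 9) ∷ (# 7 , # 5) ∷ (# 8 , # 6) ∷ (# 6 , # 5) ∷ (# 9 , # 5) ∷ []) ∷ᵥ
  ((# 0 , # 4) ∷ (# 1 , # 2) ∷ (# 2 , # 6) ∷ (# 4 , # 6) ∷ (# 5 , # 7) ∷ (# 7 , # 6) ∷ (# 8 , # 3) ∷ (# 3 , # 6) ∷ (# 9 , # 6) ∷ []) ∷ᵥ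
  ((# 0 , # 1) ∷ (# 1 , # 7) ∷ (# 2 , # 3) ∷ (# 3 , # 7) ∷ (# 5 , # 7) ∷ (# 6 , # 8) ∷ (# 8 , # 7) ∷ (# 9 , # 4) ∷ (# 4 , # 7) ∷ []) ∷ᵥ
  ((# 0 , # 1) ∷ (# 1 , # 8) ∷ (# 2 , # 7) ∷ (# 3 , # 4) ∷ (# 4 , # 8) ∷ (# 5 , # 8) ∷ (# 6 , # 9) ∷ (# 7 , # 8) ∷ (# 9 , # 8) ∷ []) ∷ᵥ
  ((# 0 , # 1) ∷ (# 1 , # 9) ∷ (# 2 , # 3) ∷ (# 3 , # 9) ∷ (# 4 , # 9) ∷ (# 5 , # 8) ∷ (# 6 , # 9) ∷ (# 7 , # 9) ∷ (# 8 , # 9) ∷ []) ∷ᵥ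
  []ᵥ

-- from-just has type Stackable Petersen only because the check evaluates to just.
corollary13 : Stackable Petersen
corollary13 = from-just (stackable? petersen? (lookup petersenScripts))
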